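{- Let $(X,+)$ be an abelian group and $\mathcal{A}$ a Sidon set in $X$. If the sum graph $G_{X,\mathcal{A}}$ is $C_4$-saturated, then $\mathcal{A}$ is maximal.
   Context: A nonempty subset $\mathcal{A}$ of an abelian group $X$ is a Sidon set if $a+b=c+d$ with $a,b,c,d\in\mathcal{A}$ implies $\{a,b\}=\{c,d\}$; it is maximal if it is not properly contained in another Sidon set in $X$. The sum graph $G_{X,\mathcal{A}}$ has vertex set $X$, and distinct $x,y$ are adjacent iff $x+y\in\mathcal{A}$. A graph is $C_4$-saturated if it contains no 4-cycle but adding any edge between two nonadjacent distinct vertices creates a 4-cycle. -}

module Defs where

open import Level using (Level; _⊔_; suc)
open import Algebra.Bundles using (AbelianGroup)
open import Data.Product using (Σ; ∃; _×_; _,_)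
open import Data.Sum using (_⊎_)
open import Relation.Nullary using (¬_)
open import Relation.Unary using (Pred; _∈_; _∉_; _⊆_)
open import Relation.Binary.Core using (Rel)

module _ {c ℓ : Level} (X : AbelianGroup c ℓ) where
  open AbelianGroup X renaming (Carrier to G)

  -- subsets of X are predicates respecting the group's (setoid) equality
  RespectsEq : {a : Level} → Pred G a → Set (c ⊔ ℓ ⊔ a)
  RespectsEq A = ∀ {x y} → x ≈ y → x ∈ A → y ∈ A

  IsSidon : {a : Level} → Pred G a → Set (c ⊔ ℓ ⊔ a)
  IsSidon A =
    (∃ λ a → a ∈ A) ×
    (∀ a b c' d → a ∈ A → b ∈ A → c' ∈ A → d ∈ A → a ∙ b ≈ c' ∙ d →
       (a ≈ c' × b ≈ d) ⊎ (a ≈ d × b ≈ c'))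

  ProperSubset : {a : Level} → Pred G a → Pred G a → Set (c ⊔ a)
  ProperSubset A B = (A ⊆ B) × (∃ λ x → x ∈ B × x ∉ A)

  IsMaximalSidon : {a : Level} → Pred G a → Set (c ⊔ ℓ ⊔ suc a)
  IsMaximalSidon {a} A =
    IsSidon A ×
    ¬ (Σ (Pred G a) λ B → RespectsEq B × IsSidon B × ProperSubset A B)

  SumGraph : {a : Level} → Pred G a → Rel G (ℓ ⊔ a)
  SumGraph A x y = ¬ (x ≈ y) × (x ∙ y) ∈ A

  -- graphs on the vertex set X are (symmetric, irreflexive) relations E
  -- a 4-cycle: four pairwise distinct vertices v1 v2 v3 v4 with
  -- v1~v2, v2~v3, v3~v4, v4~v1
  HasC4 : {e : Level} → Rel G e → Set (c ⊔ ℓ ⊔ e)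
  HasC4 E = ∃ λ v₁ → ∃ λ v₂ → ∃ λ v₃ → ∃ λ v₄ →
    (¬ v₁ ≈ v₂ × ¬ v₁ ≈ v₃ × ¬ v₁ ≈ v₄ × ¬ v₂ ≈ v₃ × ¬ v₂ ≈ v₄ × ¬ v₃ ≈ v₄) ×
    (E v₁ v₂ × E v₂ v₃ × E v₃ v₄ × E v₄ v₁)

  AddEdge : {e : Level} → Rel G e → G → G → Rel G (ℓ ⊔ e)
  AddEdge E x y u v = E u v ⊎ ((u ≈ x × v ≈ y) ⊎ (u ≈ y × v ≈ x))

  C4Saturated : {e : Level} → Rel G e → Set (c ⊔ ℓ ⊔ e)
  C4Saturated E =
    ¬ HasC4 E ×
    (∀ x y → ¬ x ≈ y → ¬ E x y → HasC4 (AddEdge E x y))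

module Submission where

-- Suppose A ⊊ B with B Sidon, and pick b ∈ B \ A. The proof rests on two facts.
--  * Sidon sets forbid 4-cycles: if every edge uv of a graph has u + v ∈ B,
--    a 4-cycle v₁v₂v₃v₄ gives (v₁+v₂) + (v₃+v₄) = (v₂+v₃) + (v₄+v₁), and the
--    Sidon property of B forces v₁ = v₃ or v₂ = v₄.
--  * b splits as b = x + y with x ≠ y: take 0 + b if b ≠ 0, and a + (-a) for
--    some a ∈ A if b = 0; in the latter case a = -a would give a + a = b + b,
--    hence a = b ∈ A by the Sidon property of B.
-- Such x, y are nonadjacent in G_{X,A} (as b ∉ A), so saturation yields a
-- 4-cycle after adding the edge xy. All edge sums of the enlarged graph lie
-- in A ∪ {b} ⊆ B, contradicting the first fact. Since group equality is a
-- setoid, the splitting is obtained only double-negated, which suffices.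

open import Defs
open import Level using (Level; _⊔_)
open import Algebra.Bundles using (AbelianGroup)
open import Relation.Unary using (Pred; _∈_)
open import Relation.Binary.Core using (Rel)
open import Relation.Nullary using (¬_)
open import Data.Product using (∃₂; _×_; _,_; proj₁)
open import Data.Sum using (inj₁; inj₂)
import Algebra.Properties.Group as GroupProperties
import Relation.Binary.Reasoning.Setoid as SetoidReasoning

module _ {c ℓ : Level} (X : AbelianGroup c ℓ) where
  open AbelianGroup X renaming (Carrier to G)
  open GroupProperties group using (∙-cancelʳ)
  open SetoidReasoning setoid

  cycleSums : ∀ v₁ v₂ v₃ v₄ → (v₁ ∙ v₂) ∙ (v₃ ∙ v₄) ≈ (v₂ ∙ v₃) ∙ (v₄ ∙ v₁)
  cycleSums v₁ v₂ v₃ v₄ = begin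
    (v₁ ∙ v₂) ∙ (v₃ ∙ v₄) ≈⟨ ∙-congʳ (comm v₁ v₂) ⟩
    (v₂ ∙ v₁) ∙ (v₃ ∙ v₄) ≈⟨ assoc v₂ v₁ (v₃ ∙ v₄) ⟩
    v₂ ∙ (v₁ ∙ (v₃ ∙ v₄)) ≈⟨ ∙-congˡ (comm v₁ (v₃ ∙ v₄)) ⟩
    v₂ ∙ ((v₃ ∙ v₄) ∙ v₁) ≈⟨ ∙-congˡ (assoc v₃ v₄ v₁) ⟩
    v₂ ∙ (v₃ ∙ (v₄ ∙ v₁)) ≈⟨ assoc v₂ v₃ (v₄ ∙ v₁) ⟨
    (v₂ ∙ v₃) ∙ (v₄ ∙ v₁) ∎

  cancelShared : ∀ u v w → u ∙ v ≈ v ∙ w → u ≈ w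
  cancelShared u v w e = ∙-cancelʳ v u w (trans e (comm v w))

  EdgeSumsIn : {a e : Level} → Pred G a → Rel G e → Set (c ⊔ a ⊔ e)
  EdgeSumsIn B E = ∀ {u v} → E u v → u ∙ v ∈ B

  sidonForbidsC4 : {a e : Level} {B : Pred G a} {E : Rel G e} →
    IsSidon X B → EdgeSumsIn B E → ¬ HasC4 X E
  sidonForbidsC4 {B = B} (_ , unique) sums
    (v₁ , v₂ , v₃ , v₄ , (_ , v₁≉v₃ , _ , _ , v₂≉v₄ , _) , (e₁₂ , e₂₃ , e₃₄ , e₄₁))
    with unique _ _ _ _ (sums e₁₂) (sums e₃₄) (sums e₂₃) (sums e₄₁) (cycleSums v₁ v₂ v₃ v₄)
  ... | inj₁ (v₁₂≈v₂₃ , _) = v₁≉v₃ (cancelShared v₁ v₂ v₃ v₁₂≈v₂₃)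
  ... | inj₂ (v₁₂≈v₄₁ , _) = v₂≉v₄ (sym (cancelShared v₄ v₁ v₂ (sym v₁₂≈v₄₁)))

  addEdgeSumsIn : {a e : Level} {B : Pred G a} {E : Rel G e} {x y : G} →
    RespectsEq X B → EdgeSumsIn B E → x ∙ y ∈ B → EdgeSumsIn B (AddEdge X E x y)
  addEdgeSumsIn respB sums xy∈B (inj₁ uv) = sums uv
  addEdgeSumsIn respB sums xy∈B (inj₂ (inj₁ (u≈x , v≈y))) =
    respB (sym (∙-cong u≈x v≈y)) xy∈B
  addEdgeSumsIn {x = x} {y} respB sums xy∈B (inj₂ (inj₂ (u≈y , v≈x))) =
    respB (sym (trans (∙-cong u≈y v≈x) (comm y x))) xy∈B

  distinctSummands : {a : Level} {B : Pred G a} {a₀ b : G} →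
    IsSidon X B → a₀ ∈ B → b ∈ B → ¬ a₀ ≈ b →
    ¬ ¬ ∃₂ λ x y → ¬ x ≈ y × x ∙ y ≈ b
  distinctSummands {a₀ = a₀} {b} (_ , unique) a₀∈B b∈B a₀≉b noSplit =
    noSplit (ε , b , ε≉b , identityˡ b)
    where
    ε≉b : ¬ ε ≈ b
    ε≉b ε≈b = noSplit (a₀ , a₀ ⁻¹ , a₀≉a₀⁻¹ , trans (inverseʳ a₀) ε≈b)
      where
      a₀≉a₀⁻¹ : ¬ a₀ ≈ a₀ ⁻¹
      a₀≉a₀⁻¹ a₀≈a₀⁻¹ with unique a₀ a₀ b b a₀∈B a₀∈B b∈B b∈B doubles
        where
        doubles : a₀ ∙ a₀ ≈ b ∙ b
        doubles = begin
          a₀ ∙ a₀    ≈⟨ ∙-congˡ a₀≈a₀⁻¹ ⟩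
          a₀ ∙ a₀ ⁻¹ ≈⟨ inverseʳ a₀ ⟩
          ε          ≈⟨ identityˡ ε ⟨
          ε ∙ ε      ≈⟨ ∙-cong ε≈b ε≈b ⟩
          b ∙ b      ∎
      ... | inj₁ (a₀≈b , _) = a₀≉b a₀≈b
      ... | inj₂ (a₀≈b , _) = a₀≉b a₀≈b

mainTheorem7 : {c ℓ a : Level} (X : AbelianGroup c ℓ) (A : Pred (AbelianGroup.Carrier X) a) →
    RespectsEq X A → IsSidon X A → C4Saturated X (SumGraph X A) → IsMaximalSidon X A
mainTheorem7 X A respA sidonA (_ , saturated) =
  sidonA , λ (B , respB , sidonB , A⊆B , b , b∈B , b∉A) →
    let open AbelianGroup X
        (a₀ , a₀∈A) = proj₁ sidonA
        a₀≉b : ¬ a₀ ≈ b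
        a₀≉b a₀≈b = b∉A (respA a₀≈b a₀∈A)
        sumGraphInB : EdgeSumsIn X B (SumGraph X A)
        sumGraphInB (_ , uv∈A) = A⊆B uv∈A
    in distinctSummands X sidonB (A⊆B a₀∈A) b∈B a₀≉b λ (x , y , x≉y , xy≈b) →
         sidonForbidsC4 X sidonB
           (addEdgeSumsIn X respB sumGraphInB (respB (sym xy≈b) b∈B))
           (saturated x y x≉y λ (_ , xy∈A) → b∉A (respA xy≈b xy∈A))
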